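{- For every integer $k\ge 0$, $\lim_{n\to\infty} P(2n-1-|S-S| = 2k) > 0$, where $S$ is a uniformly random subset of $[n]=\{0,\dots,n-1\}$.
   Context: For a positive integer $n$, $[n] := \{0,1,\dots,n-1\}$, random subsets are uniform over all $2^n$ subsets, and $S-S := \{x-y : x,y\in S\}$. (The limit exists for every $k$.) -}

module Defs where

open import Data.Nat using (ℕ; zero; suc; _+_; _*_; _^_; _≤_; _<_)
import Data.Nat as ℕ
open import Data.Integer using (ℤ; +_; _-_)
import Data.Integer as ℤ
open import Data.List using (List; []; _∷_; _++_; map; concatMap; length; filter; deduplicate; upTo)
open import Data.Product using (∃; _×_)
open import Relation.Binary.PropositionalEquality using (_≡_)

-- All subsets of a list of (distinct) elements, each as a sublist.
-- For the list [0,…,n-1] this enumerates each of the 2^n subsets of [n] exactly once.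
subsets : List ℕ → List (List ℕ)
subsets [] = [] ∷ []
subsets (x ∷ xs) = subsets xs ++ map (x ∷_) (subsets xs)

diffSet : List ℕ → List ℤ
diffSet S = deduplicate ℤ._≟_ (concatMap (λ x → map (λ y → + x - + y) S) S)

diffCard : List ℕ → ℕ
diffCard S = length (diffSet S)

-- Number of subsets S ⊆ [n] with 2n - 1 - |S - S| = 2k
-- (written without truncated subtraction as  |S-S| + 2k + 1 = 2n).
count : ℕ → ℕ → ℕ
count n k = length (filter (λ S → suc (diffCard S + 2 * k) ℕ.≟ 2 * n) (subsets (upTo n)))

-- P(2n-1-|S-S| = 2k) = count n k / 2^n.
-- "The limit of P_n is > 0" (the limit being known to exist) is stated as:
-- there are a > 0, b and N with  P_n ≥ a / b  for all n ≥ N.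
EventuallyBoundedBelow : (ℕ → ℕ) → Set
EventuallyBoundedBelow c =
  ∃ λ a → ∃ λ b → ∃ λ N → (0 < a) × (∀ n → N ≤ n → a * 2 ^ n ≤ b * c n)

module Submission where

-- Write S = k + T with T = 1^m w 1^m ⊆ [0, L), L = 2m + F, for a bit string w of length F. If T − T
-- is all of (−L, L), then |S − S| = 2L − 1, i.e. 2n − 1 − |S − S| = 2k for n = k + L; so it suffices
-- that at least half of the 2^F strings w make T − T full, and the probability is then at least
-- 2^(−k−2m−1). The two solid blocks realise every difference d < m and every d > F. A missing
-- d ∈ [m, F] forces either p = min(d, F − d) ≥ m disjoint pairs of positions (t, t + d) of w not to be
-- both set, of probability (3/4)^p, or, when F − d < m, a run of m zeros in w, of probability 2^(−m).
-- The union bound gives failure probability at most m 2^(−m) + 8 (3/4)^m, which is below 1/2 for m = 10.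

open import Defs
open import Data.Bool using (Bool; true; false; _∧_; _∨_; not)
open import Data.Bool.Properties using (T-≡)
open import Data.Empty using (⊥; ⊥-elim)
open import Data.Integer using (ℤ; +_; -[1+_]; -_; _-_; ∣_∣)
open import Data.Integer.Properties using ([+m]-[+n]≡m⊖n; ⊖-≥; ⊖-<; ∣⊖∣-≤; ∣m⊖n∣≡∣n⊖m∣)
import Data.Integer.Properties as ℤ
open import Data.List using (List; []; _∷_; _++_; map; length; filter; replicate; applyUpTo; upTo; drop)
import Data.List.Properties as List
open import Data.List.Membership.Propositional using (_∈_; find; lose)
open import Data.List.Membership.Propositional.Properties
  using (∈-map⁺; ∈-map⁻; ∈-++⁺ˡ; ∈-++⁺ʳ; ∈-++⁻; ∈-upTo⁺; ∈-upTo⁻; ∈-concatMap⁺; ∈-concatMap⁻;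
         ∈-deduplicate⁺; ∈-deduplicate⁻)
open import Data.List.Membership.Propositional.Properties.WithK using (unique∧set⇒bag)
open import Data.List.Relation.Binary.BagAndSetEquality using (∼bag⇒↭)
open import Data.List.Relation.Binary.Permutation.Propositional.Properties using (↭-length)
open import Data.List.Relation.Unary.Any using (here; there)
open import Data.List.Relation.Unary.Unique.Propositional using (Unique)
import Data.List.Relation.Unary.Unique.Propositional.Properties as Unique
open import Data.List.Relation.Unary.Unique.DecPropositional.Properties using (deduplicate-!)
open import Data.Nat using (ℕ; zero; suc; _+_; _*_; _^_; _≤_; _<_; _∸_; _≤ᵇ_; z≤n; s≤s; z<s)
open import Data.Nat.Properties
open import Algebra.Properties.CommutativeSemigroup +-commutativeSemigroup using (interchange)
open import Data.Nat.Solver using (module +-*-Solver)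
open import Data.Product using (∃-syntax; _×_; _,_)
open import Data.Sum using (_⊎_; inj₁; inj₂)
open import Function using (_∘_; id)
open import Function.Bundles using (_⇔_; mk⇔; Equivalence)
open import Relation.Binary.PropositionalEquality
open import Relation.Nullary using (Dec; yes; no; does; ¬_)
open import Relation.Nullary.Decidable using (dec-true)
open import Relation.Unary using (Pred; Decidable)

open +-*-Solver using (solve; _:+_; _:*_; _:=_; con)

-- Sums over bit strings

𝟙 : Bool → ℕ
𝟙 true = 1
𝟙 false = 0

sumBits : ℕ → (List Bool → ℕ) → ℕ
sumBits zero f = f []
sumBits (suc n) f = sumBits n (f ∘ (false ∷_)) + sumBits n (f ∘ (true ∷_))

countBits : ℕ → (List Bool → Bool) → ℕ
countBits n E = sumBits n (𝟙 ∘ E)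

sumBits-mono : ∀ n {f g : List Bool → ℕ} → (∀ u → length u ≡ n → f u ≤ g u) → sumBits n f ≤ sumBits n g
sumBits-mono zero f≤g = f≤g [] refl
sumBits-mono (suc n) f≤g = +-mono-≤ (sumBits-mono n λ u eq → f≤g (false ∷ u) (cong suc eq))
                                    (sumBits-mono n λ u eq → f≤g (true ∷ u) (cong suc eq))

sumBits-cong : ∀ n {f g : List Bool → ℕ} → (∀ u → length u ≡ n → f u ≡ g u) → sumBits n f ≡ sumBits n g
sumBits-cong zero f≡g = f≡g [] refl
sumBits-cong (suc n) f≡g = cong₂ _+_ (sumBits-cong n λ u eq → f≡g (false ∷ u) (cong suc eq))
                                     (sumBits-cong n λ u eq → f≡g (true ∷ u) (cong suc eq))

sumBits-+ : ∀ n (f g : List Bool → ℕ) → sumBits n (λ u → f u + g u) ≡ sumBits n f + sumBits n g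
sumBits-+ zero f g = refl
sumBits-+ (suc n) f g = trans (cong₂ _+_ (sumBits-+ n f₀ g₀) (sumBits-+ n f₁ g₁))
                              (interchange (sumBits n f₀) (sumBits n g₀) (sumBits n f₁) (sumBits n g₁))
  where
  f₀ f₁ g₀ g₁ : List Bool → ℕ
  f₀ = f ∘ (false ∷_)
  f₁ = f ∘ (true ∷_)
  g₀ = g ∘ (false ∷_)
  g₁ = g ∘ (true ∷_)

sumBits-*ˡ : ∀ n c (f : List Bool → ℕ) → sumBits n (λ u → c * f u) ≡ c * sumBits n f
sumBits-*ˡ zero c f = refl
sumBits-*ˡ (suc n) c f = trans (cong₂ _+_ (sumBits-*ˡ n c _) (sumBits-*ˡ n c _)) (sym (*-distribˡ-+ c _ _))

sumBits-const : ∀ n c → sumBits n (λ _ → c) ≡ 2 ^ n * c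
sumBits-const zero c = sym (*-identityˡ c)
sumBits-const (suc n) c = trans (cong₂ _+_ (sumBits-const n c) (sumBits-const n c))
                                (solve 2 (λ x c → x :* c :+ x :* c := (con 2 :* x) :* c) refl (2 ^ n) c)

sumBits-zero : ∀ n → sumBits n (λ _ → 0) ≡ 0
sumBits-zero n = trans (sumBits-const n 0) (*-zeroʳ (2 ^ n))

sumBits-++ : ∀ a b (f : List Bool → ℕ) → sumBits (a + b) f ≡ sumBits a (λ u → sumBits b (λ v → f (u ++ v)))
sumBits-++ zero b f = refl
sumBits-++ (suc a) b f = cong₂ _+_ (sumBits-++ a b _) (sumBits-++ a b _)

sumBits-++-ignoreˡ : ∀ a b {f g : List Bool → ℕ} → (∀ u v → length u ≡ a → f (u ++ v) ≡ g v) →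
  sumBits (a + b) f ≡ 2 ^ a * sumBits b g
sumBits-++-ignoreˡ a b {f} {g} f≡g = begin
  sumBits (a + b) f                               ≡⟨ sumBits-++ a b f ⟩
  sumBits a (λ u → sumBits b (λ v → f (u ++ v))) ≡⟨ sumBits-cong a (λ u |u| → sumBits-cong b λ v _ → f≡g u v |u|) ⟩
  sumBits a (λ _ → sumBits b g)                   ≡⟨ sumBits-const a _ ⟩
  2 ^ a * sumBits b g                             ∎
  where open ≡-Reasoning

sumBits-++-ignoreʳ : ∀ a b {f g : List Bool → ℕ} → (∀ u v → length u ≡ a → f (u ++ v) ≡ g u) →
  sumBits (a + b) f ≡ 2 ^ b * sumBits a g
sumBits-++-ignoreʳ a b {f} {g} f≡g = begin
  sumBits (a + b) f                               ≡⟨ sumBits-++ a b f ⟩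
  sumBits a (λ u → sumBits b (λ v → f (u ++ v))) ≡⟨ sumBits-cong a (λ u |u| → sumBits-cong b λ v _ → f≡g u v |u|) ⟩
  sumBits a (λ u → sumBits b (λ _ → g u))         ≡⟨ sumBits-cong a (λ u _ → sumBits-const b (g u)) ⟩
  sumBits a (λ u → 2 ^ b * g u)                   ≡⟨ sumBits-*ˡ a (2 ^ b) g ⟩
  2 ^ b * sumBits a g                             ∎
  where open ≡-Reasoning

sumBits-term : ∀ u (f : List Bool → ℕ) → f u ≤ sumBits (length u) f
sumBits-term [] f = ≤-refl
sumBits-term (false ∷ u) f = ≤-trans (sumBits-term u _) (m≤m+n _ _)
sumBits-term (true ∷ u) f = ≤-trans (sumBits-term u _) (m≤n+m _ _)

sumBits-prefix : ∀ u n (f : List Bool → ℕ) → sumBits n (λ v → f (u ++ v)) ≤ sumBits (length u + n) f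
sumBits-prefix [] n f = ≤-refl
sumBits-prefix (false ∷ u) n f = ≤-trans (sumBits-prefix u n _) (m≤m+n _ _)
sumBits-prefix (true ∷ u) n f = ≤-trans (sumBits-prefix u n _) (m≤n+m _ _)

sumBits-suffix : ∀ n z (f : List Bool → ℕ) → sumBits n (λ v → f (v ++ z)) ≤ sumBits (n + length z) f
sumBits-suffix zero z f = sumBits-term z f
sumBits-suffix (suc n) z f = +-mono-≤ (sumBits-suffix n z _) (sumBits-suffix n z _)

sumBits-infix : ∀ u n z (f : List Bool → ℕ) →
  sumBits n (λ v → f (u ++ (v ++ z))) ≤ sumBits (length u + (n + length z)) f
sumBits-infix u n z f = ≤-trans (sumBits-suffix n z (f ∘ (u ++_))) (sumBits-prefix u (n + length z) f)

countBits-complement : ∀ n E → countBits n E + countBits n (not ∘ E) ≡ 2 ^ n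
countBits-complement n E = begin
  countBits n E + countBits n (not ∘ E)      ≡⟨ sumBits-+ n (𝟙 ∘ E) (𝟙 ∘ not ∘ E) ⟨
  sumBits n (λ u → 𝟙 (E u) + 𝟙 (not (E u)))  ≡⟨ sumBits-cong n (λ u _ → 𝟙+𝟙not (E u)) ⟩
  sumBits n (λ _ → 1)                        ≡⟨ trans (sumBits-const n 1) (*-identityʳ (2 ^ n)) ⟩
  2 ^ n                                      ∎
  where
  open ≡-Reasoning
  𝟙+𝟙not : ∀ b → 𝟙 b + 𝟙 (not b) ≡ 1
  𝟙+𝟙not true = refl
  𝟙+𝟙not false = refl

sumBelow : ℕ → (ℕ → ℕ) → ℕ
sumBelow zero f = 0
sumBelow (suc n) f = f 0 + sumBelow n (f ∘ suc)

sumBelow-term : ∀ n f {i} → i < n → f i ≤ sumBelow n f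
sumBelow-term (suc n) f {zero} _ = m≤m+n _ _
sumBelow-term (suc n) f {suc i} (s≤s i<n) = ≤-trans (sumBelow-term n (f ∘ suc) i<n) (m≤n+m _ _)

sumBelow-hit : ∀ n (E : ℕ → Bool) {i} → i < n → E i ≡ true → 1 ≤ sumBelow n (𝟙 ∘ E)
sumBelow-hit n E i<n Ei = ≤-trans (≤-reflexive (cong 𝟙 (sym Ei))) (sumBelow-term n (𝟙 ∘ E) i<n)

sumBits-sumBelow : ∀ n J (f : ℕ → List Bool → ℕ) →
  sumBits n (λ u → sumBelow J (λ i → f i u)) ≡ sumBelow J (λ i → sumBits n (f i))
sumBits-sumBelow n zero f = sumBits-zero n
sumBits-sumBelow n (suc J) f =
  trans (sumBits-+ n (f 0) _) (cong (_+_ (sumBits n (f 0))) (sumBits-sumBelow n J (f ∘ suc)))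

sumBelow-bound : ∀ J t c K → (∀ {i} → i < J → t i * c ≤ K) → sumBelow J t * c ≤ J * K
sumBelow-bound zero t c K _ = z≤n
sumBelow-bound (suc J) t c K bound = begin
  (t 0 + sumBelow J (t ∘ suc)) * c    ≡⟨ *-distribʳ-+ c (t 0) _ ⟩
  t 0 * c + sumBelow J (t ∘ suc) * c  ≤⟨ +-mono-≤ (bound z<s) (sumBelow-bound J (t ∘ suc) c K (bound ∘ s≤s)) ⟩
  K + J * K                           ∎
  where open ≤-Reasoning

sumBelow-geometric : ∀ J c t K → (∀ i → t i * 4 ^ (c + i) ≤ 3 ^ (c + i) * K) →
  sumBelow J t * 4 ^ c ≤ 4 * 3 ^ c * K
sumBelow-geometric zero c t K _ = z≤n
sumBelow-geometric (suc J) c t K bound = begin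
  (t 0 + S) * 4 ^ c          ≡⟨ *-distribʳ-+ (4 ^ c) (t 0) S ⟩
  t 0 * 4 ^ c + S * 4 ^ c    ≤⟨ +-mono-≤ head tail ⟩
  3 ^ c * K + 3 * 3 ^ c * K  ≡⟨ solve 2 (λ x k → x :* k :+ con 3 :* x :* k := con 4 :* x :* k) refl (3 ^ c) K ⟩
  4 * 3 ^ c * K              ∎
  where
  open ≤-Reasoning
  S : ℕ
  S = sumBelow J (t ∘ suc)
  head : t 0 * 4 ^ c ≤ 3 ^ c * K
  head = subst (λ e → t 0 * 4 ^ e ≤ 3 ^ e * K) (+-identityʳ c) (bound 0)
  tail : S * 4 ^ c ≤ 3 * 3 ^ c * K
  tail = *-cancelˡ-≤ 4 (begin
    4 * (S * 4 ^ c)      ≡⟨ solve 2 (λ s x → con 4 :* (s :* x) := s :* (con 4 :* x)) refl S (4 ^ c) ⟩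
    S * 4 ^ suc c        ≤⟨ sumBelow-geometric J (suc c) (t ∘ suc) K
                              (λ i → subst (λ e → t (suc i) * 4 ^ e ≤ 3 ^ e * K) (+-suc c i) (bound (suc i))) ⟩
    4 * 3 ^ suc c * K    ≡⟨ solve 2 (λ x k → con 4 :* (con 3 :* x) :* k := con 4 :* (con 3 :* x :* k)) refl (3 ^ c) K ⟩
    4 * (3 * 3 ^ c * K)  ∎)

select : {A : Set} → List A → List Bool → List A
select [] _ = []
select (x ∷ xs) [] = []
select (x ∷ xs) (false ∷ u) = select xs u
select (x ∷ xs) (true ∷ u) = x ∷ select xs u

module _ {p} {P : Pred (List ℕ) p} (P? : Decidable P) where

  length-filter-map : ∀ (f : List ℕ → List ℕ) xss →
    length (filter P? (map f xss)) ≡ length (filter (λ xs → P? (f xs)) xss)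
  length-filter-map f [] = refl
  length-filter-map f (xs ∷ xss) with does (P? (f xs))
  ... | true = cong suc (length-filter-map f xss)
  ... | false = length-filter-map f xss

length-filter-subsets : ∀ {p} {P : Pred (List ℕ) p} (P? : Decidable P) xs →
  length (filter P? (subsets xs)) ≡ sumBits (length xs) (λ u → 𝟙 (does (P? (select xs u))))
length-filter-subsets P? [] with does (P? [])
... | true = refl
... | false = refl
length-filter-subsets P? (x ∷ xs) = begin
  length (filter P? (subsets xs ++ map (x ∷_) (subsets xs)))
    ≡⟨ cong length (List.filter-++ P? (subsets xs) _) ⟩
  length (filter P? (subsets xs) ++ filter P? (map (x ∷_) (subsets xs)))
    ≡⟨ List.length-++ (filter P? (subsets xs)) ⟩
  length (filter P? (subsets xs)) + length (filter P? (map (x ∷_) (subsets xs)))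
    ≡⟨ cong₂ _+_ (length-filter-subsets P? xs)
                 (trans (length-filter-map P? (x ∷_) (subsets xs)) (length-filter-subsets (λ ys → P? (x ∷ ys)) xs)) ⟩
  sumBits (length (x ∷ xs)) (λ u → 𝟙 (does (P? (select (x ∷ xs) u)))) ∎
  where open ≡-Reasoning

bit : List Bool → ℕ → Bool
bit [] _ = false
bit (b ∷ u) zero = b
bit (b ∷ u) (suc i) = bit u i

bit-++ˡ : ∀ u v {i} → i < length u → bit (u ++ v) i ≡ bit u i
bit-++ˡ (b ∷ u) v {zero} _ = refl
bit-++ˡ (b ∷ u) v {suc i} (s≤s i<|u|) = bit-++ˡ u v i<|u|

bit-++ʳ : ∀ u v {a} i → length u ≡ a → bit (u ++ v) (a + i) ≡ bit v i
bit-++ʳ [] v i refl = refl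
bit-++ʳ (b ∷ u) v i refl = bit-++ʳ u v i refl

bit-replicate : ∀ n b {i} → i < n → bit (replicate n b) i ≡ b
bit-replicate (suc n) b {zero} _ = refl
bit-replicate (suc n) b {suc i} (s≤s i<n) = bit-replicate n b i<n

bit-true⇒< : ∀ u {i} → bit u i ≡ true → i < length u
bit-true⇒< (b ∷ u) {zero} _ = s≤s z≤n
bit-true⇒< (b ∷ u) {suc i} eq = s≤s (bit-true⇒< u eq)

drop-++ : ∀ (u v : List Bool) {a} → length u ≡ a → drop a (u ++ v) ≡ v
drop-++ [] v refl = refl
drop-++ (b ∷ u) v refl = drop-++ u v refl

drop-+ : ∀ a b (u : List Bool) → drop (a + b) u ≡ drop b (drop a u)
drop-+ zero b u = refl
drop-+ (suc a) b [] = sym (List.drop-[] b)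
drop-+ (suc a) b (_ ∷ u) = drop-+ a b u

bit-drop : ∀ d u i → bit (drop d u) i ≡ bit u (d + i)
bit-drop zero u i = refl
bit-drop (suc d) [] i = refl
bit-drop (suc d) (b ∷ u) i = bit-drop d u i

∈-select⁻ : ∀ (f : ℕ → ℕ) n u {x} → x ∈ select (applyUpTo f n) u → ∃[ i ] i < n × bit u i ≡ true × x ≡ f i
∈-select⁻ f (suc n) (false ∷ u) x∈
  with i , i<n , eq , refl ← ∈-select⁻ (f ∘ suc) n u x∈ = suc i , s≤s i<n , eq , refl
∈-select⁻ f (suc n) (true ∷ u) (here refl) = 0 , s≤s z≤n , refl , refl
∈-select⁻ f (suc n) (true ∷ u) (there x∈)
  with i , i<n , eq , refl ← ∈-select⁻ (f ∘ suc) n u x∈ = suc i , s≤s i<n , eq , refl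

∈-select⁺ : ∀ (f : ℕ → ℕ) n u {i} → i < n → bit u i ≡ true → f i ∈ select (applyUpTo f n) u
∈-select⁺ f (suc n) (false ∷ u) {suc i} (s≤s i<n) eq = ∈-select⁺ (f ∘ suc) n u i<n eq
∈-select⁺ f (suc n) (true ∷ u) {zero} _ _ = here refl
∈-select⁺ f (suc n) (true ∷ u) {suc i} (s≤s i<n) eq = there (∈-select⁺ (f ∘ suc) n u i<n eq)

select-replicate-false : ∀ (f : ℕ → ℕ) k n u →
  select (applyUpTo f (k + n)) (replicate k false ++ u) ≡ select (applyUpTo (f ∘ _+_ k) n) u
select-replicate-false f zero n u = refl
select-replicate-false f (suc k) n u = select-replicate-false (f ∘ suc) k n u

∧-true⁻ : ∀ a {b} → a ∧ b ≡ true → a ≡ true × b ≡ true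
∧-true⁻ true b≡true = refl , b≡true

not-∧ : ∀ {a b} → (a ≡ true → b ≡ false) → not (a ∧ b) ≡ true
not-∧ {false} _ = refl
not-∧ {true} a⇒¬b rewrite a⇒¬b refl = refl

allBelow : ℕ → (ℕ → Bool) → Bool
allBelow zero f = true
allBelow (suc n) f = f 0 ∧ allBelow n (f ∘ suc)

anyBelow : ℕ → (ℕ → Bool) → Bool
anyBelow zero f = false
anyBelow (suc n) f = f 0 ∨ anyBelow n (f ∘ suc)

allBelow⁺ : ∀ n f → (∀ {i} → i < n → f i ≡ true) → allBelow n f ≡ true
allBelow⁺ zero f _ = refl
allBelow⁺ (suc n) f all rewrite all (s≤s z≤n) = allBelow⁺ n (f ∘ suc) (all ∘ s≤s)

allBelow⁻ : ∀ n f → allBelow n f ≡ true → ∀ {i} → i < n → f i ≡ true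
allBelow⁻ (suc n) f eq {i} i<n with f 0 in f0
allBelow⁻ (suc n) f eq {zero} _ | true = f0
allBelow⁻ (suc n) f eq {suc i} (s≤s i<n) | true = allBelow⁻ n (f ∘ suc) eq i<n

allBelow-false⁻ : ∀ n f → allBelow n f ≡ false → ∃[ i ] i < n × f i ≡ false
allBelow-false⁻ (suc n) f eq with f 0 in f0
... | false = 0 , s≤s z≤n , f0
... | true with i , i<n , fi ← allBelow-false⁻ n (f ∘ suc) eq = suc i , s≤s i<n , fi

allBelow-cong : ∀ n {f g} → (∀ {i} → i < n → f i ≡ g i) → allBelow n f ≡ allBelow n g
allBelow-cong zero _ = refl
allBelow-cong (suc n) f≡g = cong₂ _∧_ (f≡g (s≤s z≤n)) (allBelow-cong n (f≡g ∘ s≤s))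

anyBelow⁻ : ∀ n f → anyBelow n f ≡ true → ∃[ i ] i < n × f i ≡ true
anyBelow⁻ (suc n) f eq with f 0 in f0
... | true = 0 , s≤s z≤n , f0
... | false with i , i<n , fi ← anyBelow⁻ n (f ∘ suc) eq = suc i , s≤s i<n , fi

anyBelow-false⁻ : ∀ n f → anyBelow n f ≡ false → ∀ {i} → i < n → f i ≡ false
anyBelow-false⁻ (suc n) f eq {i} i<n with f 0 in f0
anyBelow-false⁻ (suc n) f eq {zero} _ | false = f0
anyBelow-false⁻ (suc n) f eq {suc i} (s≤s i<n) | false = anyBelow-false⁻ n (f ∘ suc) eq i<n

-- Events on bit strings and their counts

disjointOn : ℕ → List Bool → List Bool → Bool
disjointOn p u z = allBelow p (λ t → not (bit u t ∧ bit z t))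

zeroOn : ℕ → List Bool → Bool
zeroOn m v = allBelow m (not ∘ bit v)

disjointOn-++ˡ : ∀ p u v z → length u ≡ p → disjointOn p (u ++ v) z ≡ disjointOn p u z
disjointOn-++ˡ p u v z refl = allBelow-cong p λ t<p → cong (λ b → not (b ∧ bit z _)) (bit-++ˡ u v t<p)

disjointOn-++ʳ : ∀ p u z y → length z ≡ p → disjointOn p u (z ++ y) ≡ disjointOn p u z
disjointOn-++ʳ p u z y refl = allBelow-cong p λ t<p → cong (λ b → not (bit u _ ∧ b)) (bit-++ˡ z y t<p)

zeroOn-++ : ∀ m v y → length v ≡ m → zeroOn m (v ++ y) ≡ zeroOn m v
zeroOn-++ m v y refl = allBelow-cong m λ i<m → cong not (bit-++ˡ v y i<m)

-- The left-hand side is the goal unfolded at the first bits of u and z: of their four values only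
-- (1, 1) is excluded.
disjointOn-count : ∀ p → sumBits p (λ u → countBits p (disjointOn p u)) ≡ 3 ^ p
disjointOn-count zero = refl
disjointOn-count (suc p) = begin
  sumBits p (λ u → N u + N u) + sumBits p (λ u → N u + sumBits p (λ _ → 0))
    ≡⟨ cong₂ _+_ (sumBits-+ p N N) (trans (sumBits-+ p N _) (cong (_+_ (sumBits p N)) no-pairs)) ⟩
  (sumBits p N + sumBits p N) + (sumBits p N + 0)
    ≡⟨ cong (λ x → (x + x) + (x + 0)) (disjointOn-count p) ⟩
  (3 ^ p + 3 ^ p) + (3 ^ p + 0)
    ≡⟨ solve 1 (λ x → (x :+ x) :+ (x :+ con 0) := con 3 :* x) refl (3 ^ p) ⟩
  3 ^ suc p ∎
  where
  open ≡-Reasoning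
  N : List Bool → ℕ
  N u = countBits p (disjointOn p u)
  no-pairs : sumBits p (λ _ → sumBits p (λ _ → 0)) ≡ 0
  no-pairs = trans (sumBits-cong p λ _ _ → sumBits-zero p) (sumBits-zero p)

zeroOn-count : ∀ m → countBits m (zeroOn m) ≡ 1
zeroOn-count zero = refl
zeroOn-count (suc m) = cong₂ _+_ (zeroOn-count m) (sumBits-zero m)

shiftDisjoint-count : ∀ p q r →
  countBits (p + (q + (p + r))) (λ w → disjointOn p w (drop (p + q) w)) ≡ 2 ^ q * (2 ^ r * 3 ^ p)
shiftDisjoint-count p q r = begin
  sumBits (p + (q + (p + r))) f
    ≡⟨ sumBits-++ p _ f ⟩
  sumBits p (λ u → sumBits (q + (p + r)) (λ v → f (u ++ v)))
    ≡⟨ sumBits-cong p (λ u |u| → trans (sumBits-++-ignoreˡ q (p + r) (f-infix u |u|))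
                                       (cong (2 ^ q *_) (sumBits-++-ignoreʳ p r (disjointOn-suffix u)))) ⟩
  sumBits p (λ u → 2 ^ q * (2 ^ r * countBits p (disjointOn p u)))
    ≡⟨ trans (sumBits-*ˡ p (2 ^ q) _) (cong (2 ^ q *_) (sumBits-*ˡ p (2 ^ r) _)) ⟩
  2 ^ q * (2 ^ r * sumBits p (λ u → countBits p (disjointOn p u)))
    ≡⟨ cong (λ x → 2 ^ q * (2 ^ r * x)) (disjointOn-count p) ⟩
  2 ^ q * (2 ^ r * 3 ^ p) ∎
  where
  open ≡-Reasoning
  f : List Bool → ℕ
  f w = 𝟙 (disjointOn p w (drop (p + q) w))
  f-infix : ∀ u → length u ≡ p → ∀ v z → length v ≡ q → f (u ++ (v ++ z)) ≡ 𝟙 (disjointOn p u z)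
  f-infix u |u| v z |v| = cong 𝟙 (begin
    disjointOn p (u ++ (v ++ z)) (drop (p + q) (u ++ (v ++ z)))
      ≡⟨ cong (disjointOn p (u ++ (v ++ z))) (trans (drop-+ p q (u ++ (v ++ z))) (cong (drop q) (drop-++ u (v ++ z) |u|))) ⟩
    disjointOn p (u ++ (v ++ z)) (drop q (v ++ z))
      ≡⟨ trans (disjointOn-++ˡ p u (v ++ z) (drop q (v ++ z)) |u|) (cong (disjointOn p u) (drop-++ v z |v|)) ⟩
    disjointOn p u z ∎)
  disjointOn-suffix : ∀ u z y → length z ≡ p → 𝟙 (disjointOn p u (z ++ y)) ≡ 𝟙 (disjointOn p u z)
  disjointOn-suffix u z y |z| = cong 𝟙 (disjointOn-++ʳ p u z y |z|)

zeroRun-count : ∀ F a m → a + m ≤ F → countBits F (λ w → zeroOn m (drop a w)) * 2 ^ m ≡ 2 ^ F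
zeroRun-count F a m a+m≤F with r , refl ← m≤n⇒∃[o]m+o≡n a+m≤F = begin
  countBits (a + m + r) E * 2 ^ m
    ≡⟨ cong (λ l → countBits l E * 2 ^ m) (+-assoc a m r) ⟩
  countBits (a + (m + r)) E * 2 ^ m
    ≡⟨ cong (_* 2 ^ m) (sumBits-++-ignoreˡ a (m + r) (λ u v |u| → cong (𝟙 ∘ zeroOn m) (drop-++ u v |u|))) ⟩
  2 ^ a * countBits (m + r) (zeroOn m) * 2 ^ m
    ≡⟨ cong (λ c → 2 ^ a * c * 2 ^ m) (sumBits-++-ignoreʳ m r (λ v y |v| → cong 𝟙 (zeroOn-++ m v y |v|))) ⟩
  2 ^ a * (2 ^ r * countBits m (zeroOn m)) * 2 ^ m
    ≡⟨ cong (λ c → 2 ^ a * (2 ^ r * c) * 2 ^ m) (zeroOn-count m) ⟩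
  2 ^ a * (2 ^ r * 1) * 2 ^ m
    ≡⟨ solve 3 (λ x y z → x :* (y :* con 1) :* z := x :* z :* y) refl (2 ^ a) (2 ^ r) (2 ^ m) ⟩
  2 ^ a * 2 ^ m * 2 ^ r
    ≡⟨ trans (^-distribˡ-+-* 2 (a + m) r) (cong (_* 2 ^ r) (^-distribˡ-+-* 2 a m)) ⟨
  2 ^ (a + m + r) ∎
  where
  open ≡-Reasoning
  E : List Bool → Bool
  E w = zeroOn m (drop a w)

4^n≡2^n*2^n : ∀ n → 4 ^ n ≡ 2 ^ n * 2 ^ n
4^n≡2^n*2^n zero = refl
4^n≡2^n*2^n (suc n) = trans (cong (4 *_) (4^n≡2^n*2^n n))
                            (solve 1 (λ x → con 4 :* (x :* x) := (con 2 :* x) :* (con 2 :* x)) refl (2 ^ n))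

-- The guard keeps the p pairs (t, t + d), t < p, pairwise disjoint and inside w; the event then has
-- probability (3/4)^p, and otherwise it is empty.
pairEvent : ℕ → ℕ → ℕ → List Bool → Bool
pairEvent F p d w = (p ≤ᵇ d) ∧ (p + d ≤ᵇ F) ∧ disjointOn p w (drop d w)

pairEvent⁺ : ∀ {F p d w} → p ≤ d → p + d ≤ F → disjointOn p w (drop d w) ≡ true → pairEvent F p d w ≡ true
pairEvent⁺ p≤d p+d≤F disjoint
  rewrite Equivalence.to T-≡ (≤⇒≤ᵇ p≤d) | Equivalence.to T-≡ (≤⇒≤ᵇ p+d≤F) = disjoint

pairEvent-count : ∀ F p d → countBits F (pairEvent F p d) * 4 ^ p ≤ 3 ^ p * 2 ^ F
pairEvent-count F p d with p ≤ᵇ d in p≤ᵇd | p + d ≤ᵇ F in p+d≤ᵇF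
... | false | _ = ≤-trans (≤-reflexive (cong (_* 4 ^ p) (sumBits-zero F))) z≤n
... | true | false = ≤-trans (≤-reflexive (cong (_* 4 ^ p) (sumBits-zero F))) z≤n
... | true | true
  with q , refl ← m≤n⇒∃[o]m+o≡n (≤ᵇ⇒≤ p d (Equivalence.from T-≡ p≤ᵇd))
  with r , refl ← m≤n⇒∃[o]m+o≡n (≤ᵇ⇒≤ (p + (p + q)) F (Equivalence.from T-≡ p+d≤ᵇF)) = ≤-reflexive (begin
  countBits (p + (p + q) + r) E * 4 ^ p
    ≡⟨ cong (λ l → countBits l E * 4 ^ p)
            (solve 3 (λ p q r → p :+ (p :+ q) :+ r := p :+ (q :+ (p :+ r))) refl p q r) ⟩
  countBits (p + (q + (p + r))) E * 4 ^ p
    ≡⟨ cong₂ _*_ (shiftDisjoint-count p q r) (4^n≡2^n*2^n p) ⟩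
  2 ^ q * (2 ^ r * 3 ^ p) * (2 ^ p * 2 ^ p)
    ≡⟨ solve 4 (λ x y z t → x :* (y :* z) :* (t :* t) := z :* (t :* (t :* x) :* y))
               refl (2 ^ q) (2 ^ r) (3 ^ p) (2 ^ p) ⟩
  3 ^ p * (2 ^ p * (2 ^ p * 2 ^ q) * 2 ^ r)
    ≡⟨ cong (λ x → 3 ^ p * (2 ^ p * x * 2 ^ r)) (^-distribˡ-+-* 2 p q) ⟨
  3 ^ p * (2 ^ p * 2 ^ (p + q) * 2 ^ r)
    ≡⟨ cong (λ x → 3 ^ p * (x * 2 ^ r)) (^-distribˡ-+-* 2 p (p + q)) ⟨
  3 ^ p * (2 ^ (p + (p + q)) * 2 ^ r)
    ≡⟨ cong (3 ^ p *_) (^-distribˡ-+-* 2 (p + (p + q)) r) ⟨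
  3 ^ p * 2 ^ (p + (p + q) + r) ∎)
  where
  open ≡-Reasoning
  E : List Bool → Bool
  E w = disjointOn p w (drop (p + q) w)

-- Difference sets

symInterval : ℕ → List ℤ
symInterval L = map +_ (upTo (suc L)) ++ map -[1+_] (upTo L)

length-symInterval : ∀ L → length (symInterval L) ≡ suc (2 * L)
length-symInterval L = begin
  length (map +_ (upTo (suc L)) ++ map -[1+_] (upTo L))
    ≡⟨ List.length-++ (map +_ (upTo (suc L))) ⟩
  length (map +_ (upTo (suc L))) + length (map -[1+_] (upTo L))
    ≡⟨ cong₂ _+_ (List.length-map +_ (upTo (suc L))) (List.length-map -[1+_] (upTo L)) ⟩
  length (upTo (suc L)) + length (upTo L)
    ≡⟨ cong₂ _+_ (List.length-upTo (suc L)) (List.length-upTo L) ⟩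
  suc L + L
    ≡⟨ cong (λ x → suc (L + x)) (+-identityʳ L) ⟨
  suc (2 * L) ∎
  where open ≡-Reasoning

symInterval-unique : ∀ L → Unique (symInterval L)
symInterval-unique L = Unique.++⁺ (Unique.map⁺ ℤ.+-injective (Unique.upTo⁺ (suc L)))
                                  (Unique.map⁺ -[1+]-injective (Unique.upTo⁺ L)) signs-differ
  where
  -[1+]-injective : ∀ {i j} → -[1+ i ] ≡ -[1+ j ] → i ≡ j
  -[1+]-injective refl = refl
  signs-differ : ∀ {z} → ¬ (z ∈ map +_ (upTo (suc L)) × z ∈ map -[1+_] (upTo L))
  signs-differ (z∈⁺ , z∈⁻) with _ , _ , refl ← ∈-map⁻ +_ z∈⁺ | _ , _ , () ← ∈-map⁻ -[1+_] z∈⁻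

∈-symInterval⁺ : ∀ {L} z → ∣ z ∣ ≤ L → z ∈ symInterval L
∈-symInterval⁺ (+ d) d≤L = ∈-++⁺ˡ (∈-map⁺ +_ (∈-upTo⁺ (s≤s d≤L)))
∈-symInterval⁺ -[1+ j ] j<L = ∈-++⁺ʳ _ (∈-map⁺ -[1+_] (∈-upTo⁺ j<L))

∈-symInterval⁻ : ∀ {L z} → z ∈ symInterval L → ∣ z ∣ ≤ L
∈-symInterval⁻ {L} z∈ with ∈-++⁻ (map +_ (upTo (suc L))) z∈
... | inj₁ z∈⁺ with _ , d<1+L , refl ← ∈-map⁻ +_ z∈⁺ = ≤-pred (∈-upTo⁻ d<1+L)
... | inj₂ z∈⁻ with _ , j<L , refl ← ∈-map⁻ -[1+_] z∈⁻ = ∈-upTo⁻ j<L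

∈-diffSet⁺ : ∀ {S x y} → x ∈ S → y ∈ S → + x - + y ∈ diffSet S
∈-diffSet⁺ {S} {x} {y} x∈S y∈S =
  ∈-deduplicate⁺ ℤ._≟_
    (∈-concatMap⁺ (λ x → map (λ y → + x - + y) S) (lose x∈S (∈-map⁺ (λ y → + x - + y) y∈S)))

∈-diffSet⁻ : ∀ {S z} → z ∈ diffSet S → ∃[ x ] ∃[ y ] x ∈ S × y ∈ S × z ≡ + x - + y
∈-diffSet⁻ {S} z∈
  with x , x∈S , z∈row ← find (∈-concatMap⁻ (λ x → map (λ y → + x - + y) S) (∈-deduplicate⁻ ℤ._≟_ _ z∈))
  with y , y∈S , refl ← ∈-map⁻ (λ y → + x - + y) z∈row = x , y , x∈S , y∈S , refl

unique∧set⇒length≡ : ∀ {A : Set} {xs ys : List A} → Unique xs → Unique ys → (∀ {z} → z ∈ xs ⇔ z ∈ ys) →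
  length xs ≡ length ys
unique∧set⇒length≡ xs! ys! xs∼ys = ↭-length (∼bag⇒↭ (unique∧set⇒bag xs! ys! xs∼ys))

[x+d]-x≡d : ∀ x d → + (x + d) - + x ≡ + d
[x+d]-x≡d x d = trans ([+m]-[+n]≡m⊖n (x + d) x) (trans (⊖-≥ (m≤m+n x d)) (cong +_ (m+n∸m≡n x d)))

x-[x+1+j]≡-[1+j] : ∀ x j → + x - + (x + suc j) ≡ -[1+ j ]
x-[x+1+j]≡-[1+j] x j =
  trans ([+m]-[+n]≡m⊖n x (x + suc j)) (trans (⊖-< (m<m+n x z<s)) (cong (λ e → - (+ e)) (m+n∸m≡n x (suc j))))

∣+m-+n∣≡∸ : ∀ m n → ∣ + m - + n ∣ ≡ n ∸ m ⊎ ∣ + m - + n ∣ ≡ m ∸ n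
∣+m-+n∣≡∸ m n with ≤-total m n
... | inj₁ m≤n = inj₁ (trans (cong ∣_∣ ([+m]-[+n]≡m⊖n m n)) (∣⊖∣-≤ m≤n))
... | inj₂ n≤m = inj₂ (trans (cong ∣_∣ ([+m]-[+n]≡m⊖n m n)) (trans (∣m⊖n∣≡∣n⊖m∣ m n) (∣⊖∣-≤ n≤m)))

diffCard-≡ : ∀ L S → (∀ {x y} → x ∈ S → y ∈ S → x ∸ y ≤ L) → (∀ {d} → d ≤ L → ∃[ x ] x ∈ S × x + d ∈ S) →
  diffCard S ≡ suc (2 * L)
diffCard-≡ L S diam≤L covered =
  trans (unique∧set⇒length≡ (deduplicate-! ℤ._≟_ _) (symInterval-unique L) (mk⇔ ⊆interval interval⊆))
        (length-symInterval L)
  where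
  ⊆interval : ∀ {z} → z ∈ diffSet S → z ∈ symInterval L
  ⊆interval z∈ with x , y , x∈S , y∈S , refl ← ∈-diffSet⁻ z∈ with ∣+m-+n∣≡∸ x y
  ... | inj₁ eq = ∈-symInterval⁺ _ (subst (_≤ L) (sym eq) (diam≤L y∈S x∈S))
  ... | inj₂ eq = ∈-symInterval⁺ _ (subst (_≤ L) (sym eq) (diam≤L x∈S y∈S))
  interval⊆ : ∀ {z} → z ∈ symInterval L → z ∈ diffSet S
  interval⊆ {+ d} z∈ with x , x∈S , x+d∈S ← covered (∈-symInterval⁻ z∈) =
    subst (_∈ diffSet S) ([x+d]-x≡d x d) (∈-diffSet⁺ x+d∈S x∈S)
  interval⊆ { -[1+ j ]} z∈ with x , x∈S , x+1+j∈S ← covered (∈-symInterval⁻ z∈) =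
    subst (_∈ diffSet S) (x-[x+1+j]≡-[1+j] x j) (∈-diffSet⁺ x∈S x+1+j∈S)

-- The union bound m 2^(−m) + 2 · 4 (3/4)^m ≤ 1/2, with denominators cleared.
union-bound-arith : ∀ m N {B W S₁ S₂} → 2 * m * 2 ^ m + 16 * 3 ^ m ≤ 4 ^ m → B ≤ W + (S₁ + S₂) →
  W * 2 ^ m ≤ m * N → S₁ * 4 ^ m ≤ 4 * 3 ^ m * N → S₂ * 4 ^ m ≤ 4 * 3 ^ m * N → 2 * B ≤ N
union-bound-arith m N {B} {W} {S₁} {S₂} numeric B≤ W≤ S₁≤ S₂≤ =
  *-cancelʳ-≤ (2 * B) N (4 ^ m) {{m^n≢0 4 m}} (begin
  2 * B * 4 ^ m
    ≤⟨ *-monoˡ-≤ (4 ^ m) (*-monoʳ-≤ 2 B≤) ⟩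
  2 * (W + (S₁ + S₂)) * 4 ^ m
    ≡⟨ cong (2 * (W + (S₁ + S₂)) *_) (4^n≡2^n*2^n m) ⟩
  2 * (W + (S₁ + S₂)) * (X * X)
    ≡⟨ solve 4 (λ w a b x → con 2 :* (w :+ (a :+ b)) :* (x :* x)
                            := con 2 :* (w :* x) :* x :+ con 2 :* (a :* (x :* x)) :+ con 2 :* (b :* (x :* x)))
               refl W S₁ S₂ X ⟩
  2 * (W * X) * X + 2 * (S₁ * (X * X)) + 2 * (S₂ * (X * X))
    ≤⟨ +-mono-≤ (+-mono-≤ (*-monoˡ-≤ X (*-monoʳ-≤ 2 W≤)) (*-monoʳ-≤ 2 (over-4^m S₁ S₁≤)))
                (*-monoʳ-≤ 2 (over-4^m S₂ S₂≤)) ⟩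
  2 * (m * N) * X + 2 * (4 * Y * N) + 2 * (4 * Y * N)
    ≡⟨ solve 4 (λ m n x y → con 2 :* (m :* n) :* x :+ con 2 :* (con 4 :* y :* n) :+ con 2 :* (con 4 :* y :* n)
                            := (con 2 :* m :* x :+ con 16 :* y) :* n)
               refl m N X Y ⟩
  (2 * m * X + 16 * Y) * N
    ≤⟨ *-monoˡ-≤ N numeric ⟩
  4 ^ m * N
    ≡⟨ *-comm (4 ^ m) N ⟩
  N * 4 ^ m ∎)
  where
  open ≤-Reasoning
  X Y : ℕ
  X = 2 ^ m
  Y = 3 ^ m
  over-4^m : ∀ S → S * 4 ^ m ≤ 4 * Y * N → S * (X * X) ≤ 4 * Y * N
  over-4^m S = subst (λ x → S * x ≤ 4 * Y * N) (4^n≡2^n*2^n m)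

-- frame w is the indicator of T = 1^m w 1^m ⊆ [0, L), and full w says that every d < L lies in T − T.
module Frame (m F : ℕ) where

  L : ℕ
  L = m + (F + m)

  frame : List Bool → List Bool
  frame w = replicate m true ++ (w ++ replicate m true)

  length-frame : ∀ {w} → length w ≡ F → length (frame w) ≡ L
  length-frame {w} |w| = begin
    length (replicate m true ++ (w ++ replicate m true))
      ≡⟨ List.length-++ (replicate m true) ⟩
    length (replicate m true) + length (w ++ replicate m true)
      ≡⟨ cong₂ _+_ (List.length-replicate m) (trans (List.length-++ w) (cong₂ _+_ |w| (List.length-replicate m))) ⟩
    L ∎
    where open ≡-Reasoning

  realised : List Bool → ℕ → Bool
  realised w d = anyBelow L (λ x → bit (frame w) x ∧ bit (frame w) (x + d))

  full : List Bool → Bool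
  full w = allBelow L (realised w)

  Missing : List Bool → ℕ → Set
  Missing w d = ∀ {x} → x < L → bit (frame w) x ≡ true → bit (frame w) (x + d) ≡ false

  ¬full⇒missing : ∀ {w} → full w ≡ false → ∃[ d ] d < L × Missing w d
  ¬full⇒missing {w} ¬full with d , d<L , ¬realised ← allBelow-false⁻ L (realised w) ¬full =
    d , d<L , λ {x} x<L x∈ →
      subst (λ b → b ∧ bit (frame w) (x + d) ≡ false) x∈ (anyBelow-false⁻ L _ ¬realised x<L)

  module _ {w : List Bool} (|w| : length w ≡ F) where

    frame-left : ∀ {x} → x < m → bit (frame w) x ≡ true
    frame-left x<m = trans (bit-++ˡ (replicate m true) _ (subst (_ <_) (sym (List.length-replicate m)) x<m))
                           (bit-replicate m true x<m)

    frame-middle : ∀ {y} → y < F → bit (frame w) (m + y) ≡ bit w y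
    frame-middle y<F = trans (bit-++ʳ (replicate m true) _ _ (List.length-replicate m))
                             (bit-++ˡ w _ (subst (_ <_) (sym |w|) y<F))

    frame-right : ∀ {z} → z < m → bit (frame w) (m + (F + z)) ≡ true
    frame-right z<m = trans (bit-++ʳ (replicate m true) _ _ (List.length-replicate m))
                            (trans (bit-++ʳ w _ _ |w|) (bit-replicate m true z<m))

    missing-contra : ∀ {d x} → Missing w d → x < L → bit (frame w) x ≡ true → bit (frame w) (x + d) ≡ true → ⊥
    missing-contra miss x<L x∈ x+d∈ with () ← trans (sym x+d∈) (miss x<L x∈)

    ¬missing-below : ∀ {d} → d < m → ¬ Missing w d
    ¬missing-below d<m miss = missing-contra miss (<-≤-trans 0<m (m≤m+n m _)) (frame-left 0<m) (frame-left d<m)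
      where
      0<m : 0 < m
      0<m = <-≤-trans z<s d<m

    -- The witness x = m + F − d (or 0 when d > m + F) lies in the left block and x + d in the right one.
    ¬missing-above : ∀ {d} → F < d → d < L → ¬ Missing w d
    ¬missing-above {d} F<d d<L miss with d ≤? m + F
    ... | yes d≤m+F with s , d+s≡m+F ← m≤n⇒∃[o]m+o≡n d≤m+F =
      missing-contra miss (<-≤-trans s<m (m≤m+n m _)) (frame-left s<m)
                     (subst (λ x → bit (frame w) x ≡ true) m+F+0≡s+d (frame-right (<-≤-trans z<s s<m)))
      where
      s<m : s < m
      s<m = +-cancelʳ-< F s m (subst (s + F <_) (trans (+-comm s d) d+s≡m+F) (+-monoʳ-< s F<d))
      m+F+0≡s+d : m + (F + 0) ≡ s + d
      m+F+0≡s+d = trans (cong (_+_ m) (+-identityʳ F)) (trans (sym d+s≡m+F) (+-comm d s))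
    ... | no d≰m+F with z , m+F+z≡d ← m≤n⇒∃[o]m+o≡n (<⇒≤ (≰⇒> d≰m+F)) =
      missing-contra miss (<-≤-trans 0<m (m≤m+n m _)) (frame-left 0<m)
                     (subst (λ x → bit (frame w) x ≡ true) (trans (sym (+-assoc m F z)) m+F+z≡d) (frame-right z<m))
      where
      z<m : z < m
      z<m = +-cancelˡ-< (m + F) z m (subst₂ _<_ (sym m+F+z≡d) (sym (+-assoc m F m)) d<L)
      0<m : 0 < m
      0<m = <-≤-trans z<s z<m

    missing⇒disjointOn : ∀ {d} p → Missing w d → p + d ≤ F → disjointOn p w (drop d w) ≡ true
    missing⇒disjointOn {d} p miss p+d≤F = allBelow⁺ p _ λ t<p → not-∧ (shifted-clear t<p)
      where
      open ≡-Reasoning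
      shifted-clear : ∀ {t} → t < p → bit w t ≡ true → bit (drop d w) t ≡ false
      shifted-clear {t} t<p t∈w = begin
        bit (drop d w) t             ≡⟨ bit-drop d w t ⟩
        bit w (d + t)                ≡⟨ frame-middle d+t<F ⟨
        bit (frame w) (m + (d + t))
          ≡⟨ cong (bit (frame w)) (solve 3 (λ m d t → m :+ (d :+ t) := (m :+ t) :+ d) refl m d t) ⟩
        bit (frame w) ((m + t) + d)
          ≡⟨ miss (+-monoʳ-< m (<-≤-trans t<F (m≤m+n F m))) (trans (frame-middle t<F) t∈w) ⟩
        false                        ∎
        where
        t+d<F : t + d < F
        t+d<F = <-≤-trans (+-monoˡ-< d t<p) p+d≤F
        d+t<F : d + t < F
        d+t<F = subst (_< F) (+-comm t d) t+d<F
        t<F : t < F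
        t<F = ≤-<-trans (m≤m+n t d) t+d<F

    missing⇒zeroOn : ∀ {a} → Missing w (m + a) → a + m ≤ F → zeroOn m (drop a w) ≡ true
    missing⇒zeroOn {a} miss a+m≤F = allBelow⁺ m _ λ {i} i<m → cong not (begin
      bit (drop a w) i             ≡⟨ bit-drop a w i ⟩
      bit w (a + i)                ≡⟨ frame-middle (<-≤-trans (+-monoʳ-< a i<m) a+m≤F) ⟨
      bit (frame w) (m + (a + i))
        ≡⟨ cong (bit (frame w)) (solve 3 (λ m a i → m :+ (a :+ i) := i :+ (m :+ a)) refl m a i) ⟩
      bit (frame w) (i + (m + a))  ≡⟨ miss (<-≤-trans i<m (m≤m+n m _)) (frame-left i<m) ⟩
      false                        ∎)
      where open ≡-Reasoning

  -- A missing difference d = m + a ≤ F is caught by E₁ a (when 2d ≤ F: d pairs (t, t + d)), by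
  -- E₂ (F − d − m) (when d + m ≤ F < 2d: F − d pairs), or by Z (F − d) (when F < d + m: the m bits
  -- of w at positions a, …, a + m − 1 face the left block and must vanish).
  E₁ E₂ Z : ℕ → List Bool → Bool
  E₁ i = pairEvent F (m + i) (m + i)
  E₂ i = pairEvent F (m + i) (F ∸ (m + i))
  Z j w = zeroOn m (drop (F ∸ j ∸ m) w)

  #Z #E₁ #E₂ eventCount : List Bool → ℕ
  #Z w = sumBelow m (λ j → 𝟙 (Z j w))
  #E₁ w = sumBelow (suc F) (λ i → 𝟙 (E₁ i w))
  #E₂ w = sumBelow (suc F) (λ i → 𝟙 (E₂ i w))
  eventCount w = #Z w + (#E₁ w + #E₂ w)

  module _ {w : List Bool} (|w| : length w ≡ F) where

    middle-missing⇒event : ∀ {a} → m + a ≤ F → Missing w (m + a) → 1 ≤ eventCount w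
    middle-missing⇒event {a} d≤F miss with (m + a) + (m + a) ≤? F | (m + a) + m ≤? F
    ... | yes d+d≤F | _ = ≤-trans (sumBelow-hit (suc F) (λ i → E₁ i w) (s≤s a≤F) hit)
                                  (≤-trans (m≤m+n (#E₁ w) (#E₂ w)) (m≤n+m _ (#Z w)))
      where
      a≤F : a ≤ F
      a≤F = ≤-trans (m≤n+m a m) d≤F
      hit : E₁ a w ≡ true
      hit = pairEvent⁺ {p = m + a} {w = w} ≤-refl d+d≤F (missing⇒disjointOn |w| (m + a) miss d+d≤F)
    ... | no d+d≰F | yes d+m≤F = ≤-trans (sumBelow-hit (suc F) (λ i → E₂ i w) (s≤s i≤F) hit)
                                         (≤-trans (m≤n+m (#E₂ w) (#E₁ w)) (m≤n+m _ (#Z w)))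
      where
      d p i : ℕ
      d = m + a
      p = F ∸ d
      i = p ∸ m
      i≤F : i ≤ F
      i≤F = ≤-trans (m∸n≤m p m) (m∸n≤m F d)
      m+i≡p : m + i ≡ p
      m+i≡p = m+[n∸m]≡n (m+n≤o⇒m≤o∸n m (subst (_≤ F) (+-comm d m) d+m≤F))
      p+d≤F : p + d ≤ F
      p+d≤F = ≤-reflexive (m∸n+n≡m d≤F)
      F∸[m+i]≡d : F ∸ (m + i) ≡ d
      F∸[m+i]≡d = trans (cong (F ∸_) m+i≡p) (m∸[m∸n]≡n d≤F)
      hit : E₂ i w ≡ true
      hit = subst₂ (λ p′ d′ → pairEvent F p′ d′ w ≡ true) (sym m+i≡p) (sym F∸[m+i]≡d)
                   (pairEvent⁺ {p = p} {w = w} (m≤n+o⇒m∸n≤o F d (<⇒≤ (≰⇒> d+d≰F))) p+d≤F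
                               (missing⇒disjointOn |w| p miss p+d≤F))
    ... | no _ | no d+m≰F = ≤-trans (sumBelow-hit m (λ j → Z j w) j<m hit) (m≤m+n (#Z w) _)
      where
      d j : ℕ
      d = m + a
      j = F ∸ d
      j<m : j < m
      j<m = +-cancelˡ-< d j m (subst (_< d + m) (sym (m+[n∸m]≡n d≤F)) (≰⇒> d+m≰F))
      hit : Z j w ≡ true
      hit = subst (λ s → zeroOn m (drop s w) ≡ true) (sym (trans (cong (_∸ m) (m∸[m∸n]≡n d≤F)) (m+n∸m≡n m a)))
                  (missing⇒zeroOn |w| miss (subst (_≤ F) (+-comm m a) d≤F))

    missing⇒event : ∀ {d} → d < L → Missing w d → 1 ≤ eventCount w
    missing⇒event {d} d<L miss with d <? m | F <? d
    ... | yes d<m | _ = ⊥-elim (¬missing-below |w| d<m miss)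
    ... | no _ | yes F<d = ⊥-elim (¬missing-above |w| F<d d<L miss)
    ... | no d≮m | no d≯F with a , refl ← m≤n⇒∃[o]m+o≡n (≮⇒≥ d≮m) = middle-missing⇒event (≮⇒≥ d≯F) miss

    ¬full≤eventCount : 𝟙 (not (full w)) ≤ eventCount w
    ¬full≤eventCount with full w in full≡
    ... | true = z≤n
    ... | false with d , d<L , miss ← ¬full⇒missing full≡ = missing⇒event d<L miss

  ΣZ ΣE₁ ΣE₂ : ℕ
  ΣZ = sumBelow m (λ j → countBits F (Z j))
  ΣE₁ = sumBelow (suc F) (λ i → countBits F (E₁ i))
  ΣE₂ = sumBelow (suc F) (λ i → countBits F (E₂ i))

  ¬full-count≤ : countBits F (not ∘ full) ≤ ΣZ + (ΣE₁ + ΣE₂)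
  ¬full-count≤ = ≤-trans (sumBits-mono F (λ _ |w| → ¬full≤eventCount |w|)) (≤-reflexive (begin
    sumBits F eventCount
      ≡⟨ sumBits-+ F #Z _ ⟩
    sumBits F #Z + sumBits F (λ w → #E₁ w + #E₂ w)
      ≡⟨ cong (_+_ (sumBits F #Z)) (sumBits-+ F #E₁ #E₂) ⟩
    sumBits F #Z + (sumBits F #E₁ + sumBits F #E₂)
      ≡⟨ cong₂ _+_ (sumBits-sumBelow F m (λ j w → 𝟙 (Z j w)))
                   (cong₂ _+_ (sumBits-sumBelow F (suc F) (λ i w → 𝟙 (E₁ i w)))
                              (sumBits-sumBelow F (suc F) (λ i w → 𝟙 (E₂ i w)))) ⟩
    ΣZ + (ΣE₁ + ΣE₂) ∎))
    where open ≡-Reasoning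

  Z-count : ∀ {j} → 2 * m ≤ F → j < m → countBits F (Z j) * 2 ^ m ≡ 2 ^ F
  Z-count {j} 2m≤F j<m = zeroRun-count F (F ∸ j ∸ m) m (≤-trans (≤-reflexive (m∸n+n≡m m≤F∸j)) (m∸n≤m F j))
    where
    m≤F∸j : m ≤ F ∸ j
    m≤F∸j = m+n≤o⇒m≤o∸n m (≤-trans (+-monoʳ-≤ m (<⇒≤ j<m)) (subst (_≤ F) (cong (_+_ m) (+-identityʳ m)) 2m≤F))

  ¬full-at-most-half : 2 * m ≤ F → 2 * m * 2 ^ m + 16 * 3 ^ m ≤ 4 ^ m → 2 * countBits F (not ∘ full) ≤ 2 ^ F
  ¬full-at-most-half 2m≤F numeric = union-bound-arith m (2 ^ F) {W = ΣZ} {ΣE₁} {ΣE₂} numeric ¬full-count≤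
    (sumBelow-bound m (λ j → countBits F (Z j)) (2 ^ m) (2 ^ F) (≤-reflexive ∘ Z-count 2m≤F))
    (sumBelow-geometric (suc F) m (λ i → countBits F (E₁ i)) (2 ^ F) (λ i → pairEvent-count F (m + i) (m + i)))
    (sumBelow-geometric (suc F) m (λ i → countBits F (E₂ i)) (2 ^ F) (λ i → pairEvent-count F (m + i) (F ∸ (m + i))))

  full-at-least-half : 2 * m ≤ F → 2 * m * 2 ^ m + 16 * 3 ^ m ≤ 4 ^ m → 2 ^ F ≤ 2 * countBits F full
  full-at-least-half 2m≤F numeric = +-cancelʳ-≤ (2 ^ F) (2 ^ F) (2 * G) (begin
    2 ^ F + 2 ^ F        ≡⟨ cong (λ x → x + x) (countBits-complement F full) ⟨
    (G + B) + (G + B)    ≡⟨ solve 2 (λ g b → (g :+ b) :+ (g :+ b) := con 2 :* g :+ con 2 :* b) refl G B ⟩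
    2 * G + 2 * B        ≤⟨ +-monoʳ-≤ (2 * G) (¬full-at-most-half 2m≤F numeric) ⟩
    2 * G + 2 ^ F        ∎)
    where
    open ≤-Reasoning
    G B : ℕ
    G = countBits F full
    B = countBits F (not ∘ full)

-- Subsets with a full difference set

-- The block length is suc m′, so that L = suc L′ holds definitionally.
module Embedding (k m′ F : ℕ) where
  open Frame (suc m′) F

  L′ n : ℕ
  L′ = m′ + (F + suc m′)
  n = k + L

  target? : (S : List ℕ) → Dec (suc (diffCard S + 2 * k) ≡ 2 * n)
  target? S = suc (diffCard S + 2 * k) ≟ 2 * n

  embed : List Bool → List Bool
  embed w = replicate k false ++ frame w

  module _ {w : List Bool} (|w| : length w ≡ F) (full≡ : full w ≡ true) where

    S : List ℕ
    S = select (applyUpTo (_+_ k) L) (frame w)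

    diameter : ∀ {x y} → x ∈ S → y ∈ S → x ∸ y ≤ L′
    diameter x∈ y∈ with i , i<L , _ , refl ← ∈-select⁻ (_+_ k) L (frame w) x∈
                   with j , _ , _ , refl ← ∈-select⁻ (_+_ k) L (frame w) y∈ =
      ≤-trans (≤-reflexive ([m+n]∸[m+o]≡n∸o k i j)) (≤-trans (m∸n≤m i j) (≤-pred i<L))

    covered : ∀ {d} → d ≤ L′ → ∃[ x ] x ∈ S × x + d ∈ S
    covered {d} d≤L′ with x , x<L , both ← anyBelow⁻ L _ (allBelow⁻ L (realised w) full≡ (s≤s d≤L′))
                     with x∈ , x+d∈ ← ∧-true⁻ (bit (frame w) x) both =
      k + x , ∈-select⁺ (_+_ k) L (frame w) x<L x∈ ,
      subst (_∈ S) (sym (+-assoc k x d))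
            (∈-select⁺ (_+_ k) L (frame w) (subst (x + d <_) (length-frame |w|) (bit-true⇒< (frame w) x+d∈)) x+d∈)

    full⇒target : suc (diffCard (select (upTo n) (embed w)) + 2 * k) ≡ 2 * n
    full⇒target = begin
      suc (diffCard (select (upTo n) (embed w)) + 2 * k)
        ≡⟨ cong (λ S′ → suc (diffCard S′ + 2 * k)) (select-replicate-false id k L (frame w)) ⟩
      suc (diffCard S + 2 * k)
        ≡⟨ cong (λ c → suc (c + 2 * k)) (diffCard-≡ L′ S diameter covered) ⟩
      suc (suc (2 * L′) + 2 * k)
        ≡⟨ solve 2 (λ l k → con 1 :+ ((con 1 :+ con 2 :* l) :+ con 2 :* k) := con 2 :* (k :+ (con 1 :+ l)))
                   refl L′ k ⟩
      2 * n ∎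
      where open ≡-Reasoning

  full-count≤count : countBits F full ≤ count n k
  full-count≤count = begin
    countBits F full                                          ≤⟨ sumBits-mono F full≤target ⟩
    sumBits F (λ w → target (blocks ++ (w ++ ones)))          ≤⟨ sumBits-infix blocks F ones target ⟩
    sumBits (length blocks + (F + length ones)) target        ≡⟨ cong (λ l → sumBits l target) length≡n ⟩
    sumBits n target                                          ≡⟨ cong (λ l → sumBits l target) (List.length-upTo n) ⟨
    sumBits (length (upTo n)) target                          ≡⟨ length-filter-subsets target? (upTo n) ⟨
    count n k                                                 ∎
    where
    open ≤-Reasoning
    ones blocks : List Bool
    ones = replicate (suc m′) true
    blocks = replicate k false ++ ones
    target : List Bool → ℕ
    target u = 𝟙 (does (target? (select (upTo n) u)))
    full≤target : ∀ w → length w ≡ F → 𝟙 (full w) ≤ target (blocks ++ (w ++ ones))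
    full≤target w |w| with full w in full≡
    ... | false = z≤n
    ... | true = ≤-reflexive (sym (begin-equality
      target (blocks ++ (w ++ ones))  ≡⟨ cong target (List.++-assoc (replicate k false) ones (w ++ ones)) ⟩
      target (embed w)
        ≡⟨ cong 𝟙 (dec-true (target? (select (upTo n) (embed w))) (full⇒target |w| full≡)) ⟩
      1                               ∎))
    length≡n : length blocks + (F + length ones) ≡ n
    length≡n = begin-equality
      length blocks + (F + length ones)
        ≡⟨ cong₂ _+_ (List.length-++ (replicate k false)) (cong (_+_ F) (List.length-replicate (suc m′))) ⟩
      (length (replicate k false) + length ones) + (F + suc m′)
        ≡⟨ cong (λ x → x + (F + suc m′)) (cong₂ _+_ (List.length-replicate k) (List.length-replicate (suc m′))) ⟩
      (k + suc m′) + (F + suc m′)         ≡⟨ +-assoc k (suc m′) (F + suc m′) ⟩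
      n                                   ∎

  count-lower-bound : 2 * suc m′ ≤ F → 2 * suc m′ * 2 ^ suc m′ + 16 * 3 ^ suc m′ ≤ 4 ^ suc m′ →
    2 ^ n ≤ 2 ^ k * 4 ^ suc m′ * 2 * count n k
  count-lower-bound 2m≤F numeric = begin
    2 ^ (k + (m + (F + m)))                 ≡⟨ 2^n≡ ⟩
    2 ^ k * 4 ^ m * 2 ^ F                   ≤⟨ *-monoʳ-≤ (2 ^ k * 4 ^ m) (full-at-least-half 2m≤F numeric) ⟩
    2 ^ k * 4 ^ m * (2 * countBits F full)  ≤⟨ *-monoʳ-≤ (2 ^ k * 4 ^ m) (*-monoʳ-≤ 2 full-count≤count) ⟩
    2 ^ k * 4 ^ m * (2 * count n k)         ≡⟨ *-assoc (2 ^ k * 4 ^ m) 2 (count n k) ⟨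
    2 ^ k * 4 ^ m * 2 * count n k           ∎
    where
    open ≤-Reasoning
    m : ℕ
    m = suc m′
    2^n≡ : 2 ^ (k + (m + (F + m))) ≡ 2 ^ k * 4 ^ m * 2 ^ F
    2^n≡ = begin-equality
      2 ^ (k + (m + (F + m)))
        ≡⟨ trans (^-distribˡ-+-* 2 k _)
                 (cong (2 ^ k *_) (trans (^-distribˡ-+-* 2 m _) (cong (2 ^ m *_) (^-distribˡ-+-* 2 F m)))) ⟩
      2 ^ k * (2 ^ m * (2 ^ F * 2 ^ m))
        ≡⟨ solve 3 (λ a b c → a :* (b :* (c :* b)) := a :* (b :* b) :* c) refl (2 ^ k) (2 ^ m) (2 ^ F) ⟩
      2 ^ k * (2 ^ m * 2 ^ m) * 2 ^ F
        ≡⟨ cong (λ x → 2 ^ k * x * 2 ^ F) (4^n≡2^n*2^n m) ⟨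
      2 ^ k * 4 ^ m * 2 ^ F ∎

corollary3p6 : ∀ (k : ℕ) → EventuallyBoundedBelow (λ n → count n k)
corollary3p6 k = 1 , 2 ^ k * 4 ^ 10 * 2 , k + 40 , z<s , bound
  where
  numeric : 2 * 10 * 2 ^ 10 + 16 * 3 ^ 10 ≤ 4 ^ 10
  numeric = ≤ᵇ⇒≤ _ _ _
  bound : ∀ n → k + 40 ≤ n → 1 * 2 ^ n ≤ 2 ^ k * 4 ^ 10 * 2 * count n k
  bound n k+40≤n with c , refl ← m≤n⇒∃[o]m+o≡n k+40≤n =
    subst (λ n → 1 * 2 ^ n ≤ 2 ^ k * 4 ^ 10 * 2 * count n k)
          (solve 2 (λ k c → k :+ (con 10 :+ ((con 20 :+ c) :+ con 10)) := k :+ con 40 :+ c) refl k c)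
          (≤-trans (≤-reflexive (*-identityˡ _)) (Embedding.count-lower-bound k 9 (20 + c) (m≤m+n 20 c) numeric))
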